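{- Let $n=4k+1$ be a positive integer. Let $R(x,y,t,z)=(4xyz-1)(3+4t)-4x^2y$, so that $R(x,1,t,z)=(4xz-1)(3+4t)-4x^2$. The following are equivalent: (i) there exist positive integers $x_0,z_0$ and an integer $t_0\ge0$ with $n=R(x_0,1,t_0,z_0)$; (ii) there exist positive integers $d,m$ with $-n\equiv 4d^2\pmod{4dm-1}$; (iii) there exist positive integers $u,v,w$ with $\frac4n=\frac{1}{uv}+\frac{1}{uwn}+\frac{1}{vwn}$; (iv) there exist an integer $t\ge 0$ and positive integers $a,b$ with $ab=k+1+t$ and $3+4t\mid a+b$. -}

module Defs where

open import Data.Nat as ℕ using (ℕ; suc)
open import Data.Integer as ℤ using (ℤ; +_)
open import Data.Rational as ℚ using (ℚ)

R : ℤ → ℤ → ℤ → ℤ → ℤ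
R x y t z = ((+ 4) ℤ.* x ℤ.* y ℤ.* z ℤ.- + 1) ℤ.* (+ 3 ℤ.+ (+ 4) ℤ.* t) ℤ.- (+ 4) ℤ.* x ℤ.* x ℤ.* y

inv : (m : ℕ) → .{{ℕ.NonZero m}} → ℚ
inv m = + 1 ℚ./ m

{-# OPTIONS --safe #-}
module Submission where

open import Defs
open import Data.Nat as ℕ using (ℕ; zero; suc; _*_; _+_; _<_; _∸_; _%_; NonZero; z<s; s≤s; >-nonZero⁻¹)
import Data.Nat.Properties as ℕP
open import Data.Nat.DivMod using (%-distribˡ-*; [m+kn]%n≡m%n; m%n<n; m≡m%n+[m/n]*n; _/_)
open import Data.Nat.Divisibility using (_∣_; divides)
import Data.Nat.Tactic.RingSolver as ℕSolver
open import Data.Integer as ℤ using (ℤ; +_)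
import Data.Integer.Properties as ℤP
import Data.Integer.Tactic.RingSolver as ℤSolver
open import Algebra.Properties.AbelianGroup ℤP.+-0-abelianGroup using (∙-cancelʳ)
open import Data.Integer.Divisibility as ℤD using ()
open import Data.Rational as ℚ using (toℚᵘ)
import Data.Rational.Properties as ℚP
open import Data.Rational.Unnormalised as ℚᵘ using (mkℚᵘ; *≡*) renaming (_≃_ to _≃ᵘ_)
import Data.Rational.Unnormalised.Properties as ℚᵘP
open import Data.Product using (_×_; _,_; ∃-syntax)
open import Data.Empty using (⊥-elim)
open import Function.Bundles using (_⇔_; mk⇔; module Equivalence)
open Equivalence using (to; from)
import Function.Properties.Equivalence as ⇔
open import Relation.Binary.PropositionalEquality
  using (_≡_; refl; sym; trans; cong; cong₂; subst; module ≡-Reasoning)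

-- Write S = 3 + 4t.  Since n + S = 4(k + 1 + t), the equation n = (4xz − 1)S − 4x² of (i)
-- says x² + (k + 1 + t) = x·zS, i.e. x divides k + 1 + t with a cofactor b such that
-- x + b = zS: this is (iv) with a = x.  Condition (ii) is (i) with the quotient S of
-- n + 4d² by 4dm − 1 left implicit; it is automatically 3 mod 4, because n + 4d² ≡ 1
-- and 4dm − 1 ≡ 3 (mod 4).  Clearing denominators, (iii) reads 4uvw = wn + u + v; this
-- forces uv > k, and writing uv = k + 1 + t it becomes u + v = w(3 + 4t), which is (iv).

x*x+c≡x*y⇔ : ∀ x c y .{{_ : NonZero x}} → (x * x + c ≡ x * y) ⇔ (∃[ b ] (x * b ≡ c × x + b ≡ y))
x*x+c≡x*y⇔ x c y = mk⇔
  (λ eq → let x+[y∸x]≡y = ℕP.m+[n∸m]≡n (x≤y eq) in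
    y ∸ x , sym (ℕP.+-cancelˡ-≡ (x * x) c (x * (y ∸ x))
                  (trans eq (trans (cong (x *_) (sym x+[y∸x]≡y)) (ℕP.*-distribˡ-+ x x (y ∸ x))))) , x+[y∸x]≡y)
  (λ { (b , xb≡c , x+b≡y) → begin
    x * x + c       ≡⟨ cong (λ m → x * x + m) xb≡c ⟨
    x * x + x * b   ≡⟨ ℕP.*-distribˡ-+ x x b ⟨
    x * (x + b)     ≡⟨ cong (x *_) x+b≡y ⟩
    x * y           ∎ })
  where
  open ≡-Reasoning
  x≤y : x * x + c ≡ x * y → x ℕ.≤ y
  x≤y eq = ℕP.*-cancelˡ-≤ x (subst (x * x ℕ.≤_) eq (ℕP.m≤m+n (x * x) c))

+≡suc*⇔ : ∀ a s y → (a + s ≡ suc y * s) ⇔ a ≡ s * y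
+≡suc*⇔ a s y = mk⇔
  (λ eq → trans (ℕP.+-cancelʳ-≡ s a (y * s) (trans eq (ℕP.+-comm s (y * s)))) (ℕP.*-comm y s))
  (λ eq → trans (ℕP.+-comm a s) (cong (λ m → s + m) (trans eq (ℕP.*-comm s y))))

m*n≡1+o⇒n>0 : ∀ m n {o} → m * n ≡ suc o → 0 < n
m*n≡1+o⇒n>0 m zero    eq = ⊥-elim (ℕP.0≢1+n (trans (sym (ℕP.*-zeroʳ m)) eq))
m*n≡1+o⇒n>0 m (suc n) _  = z<s

cofactor≡3-mod-4 : ∀ q s → s % 4 ≡ 3 → (q * s) % 4 ≡ 1 → ∃[ t ] q ≡ 3 + 4 * t
cofactor≡3-mod-4 q s s≡3 qs≡1 = q / 4 , (begin
  q                   ≡⟨ m≡m%n+[m/n]*n q 4 ⟩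
  q % 4 + q / 4 * 4   ≡⟨ cong₂ _+_ (residue≡3 (m%n<n q 4) 3r≡1) (ℕP.*-comm (q / 4) 4) ⟩
  3 + 4 * (q / 4)     ∎)
  where
  open ≡-Reasoning
  3r≡1 : (q % 4 * 3) % 4 ≡ 1
  3r≡1 = trans (cong (λ r → (q % 4 * r) % 4) (sym s≡3)) (trans (sym (%-distribˡ-* q s 4)) qs≡1)
  residue≡3 : ∀ {r} → r < 4 → (r * 3) % 4 ≡ 1 → r ≡ 3
  residue≡3 {0} _ ()
  residue≡3 {1} _ ()
  residue≡3 {2} _ ()
  residue≡3 {3} _ _ = refl
  residue≡3 {suc (suc (suc (suc _)))} (s≤s (s≤s (s≤s (s≤s ())))) _

toℚᵘ-/ : ∀ i d .{{_ : NonZero d}} → toℚᵘ (i ℚ./ d) ≃ᵘ i ℚᵘ./ d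
toℚᵘ-/ i (suc d) = ℚP.toℚᵘ-fromℚᵘ (mkℚᵘ i d)

/ᵘ-+-/ᵘ : ∀ m n a b → + m ℚᵘ./ suc a ℚᵘ.+ + n ℚᵘ./ suc b ≡ + (m * suc b + n * suc a) ℚᵘ./ (suc a * suc b)
/ᵘ-+-/ᵘ m n a b =
  cong (ℚᵘ._/ (suc a * suc b)) (sym (cong₂ ℤ._+_ (ℤP.pos-* m (suc b)) (ℤP.pos-* n (suc a))))

/ᵘ-≃-/ᵘ⇔ : ∀ m n a b .{{_ : NonZero a}} .{{_ : NonZero b}} →
           (+ m ℚᵘ./ a ≃ᵘ + n ℚᵘ./ b) ⇔ m * b ≡ n * a
/ᵘ-≃-/ᵘ⇔ m n a@(suc _) b@(suc _) = mk⇔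
  (λ { (*≡* eq) → ℤP.+-injective (trans (ℤP.pos-* m b) (trans eq (sym (ℤP.pos-* n a)))) })
  (λ eq → *≡* (trans (sym (ℤP.pos-* m b)) (trans (cong +_ eq) (ℤP.pos-* n a))))

/≡inv+inv+inv⇔ : ∀ p d a b c .{{_ : NonZero d}} .{{_ : NonZero a}} .{{_ : NonZero b}} .{{_ : NonZero c}} →
  (+ p ℚ./ d ≡ inv a ℚ.+ inv b ℚ.+ inv c) ⇔ p * (a * b * c) ≡ (b * c + a * c + a * b) * d
/≡inv+inv+inv⇔ p d a@(suc a-1) b@(suc b-1) c@(suc c-1) = mk⇔
  (λ eq → to cross-multiplied
    (ℚᵘP.≃-trans (ℚᵘP.≃-sym (toℚᵘ-/ (+ p) d)) (ℚᵘP.≃-trans (ℚP.toℚᵘ-cong eq) toℚᵘ-inv+inv+inv)))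
  (λ eq → ℚP.toℚᵘ-injective
    (ℚᵘP.≃-trans (toℚᵘ-/ (+ p) d)
                 (ℚᵘP.≃-trans (from cross-multiplied eq) (ℚᵘP.≃-sym toℚᵘ-inv+inv+inv))))
  where
  cross-multiplied : (+ p ℚᵘ./ d ≃ᵘ + (b * c + a * c + a * b) ℚᵘ./ (a * b * c))
                     ⇔ p * (a * b * c) ≡ (b * c + a * c + a * b) * d
  cross-multiplied = /ᵘ-≃-/ᵘ⇔ p (b * c + a * c + a * b) d (a * b * c)
  numerator : ∀ a b c → (1 * b + 1 * a) * c + 1 * (a * b) ≡ b * c + a * c + a * b
  numerator = ℕSolver.solve-∀
  toℚᵘ-inv+inv+inv : toℚᵘ (inv a ℚ.+ inv b ℚ.+ inv c) ≃ᵘ + (b * c + a * c + a * b) ℚᵘ./ (a * b * c)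
  toℚᵘ-inv+inv+inv = begin
    toℚᵘ (inv a ℚ.+ inv b ℚ.+ inv c)
      ≈⟨ ℚP.toℚᵘ-homo-+ (inv a ℚ.+ inv b) (inv c) ⟩
    toℚᵘ (inv a ℚ.+ inv b) ℚᵘ.+ toℚᵘ (inv c)
      ≈⟨ ℚᵘP.+-cong (ℚᵘP.≃-trans (ℚP.toℚᵘ-homo-+ (inv a) (inv b))
                                  (ℚᵘP.+-cong (toℚᵘ-/ (+ 1) a) (toℚᵘ-/ (+ 1) b)))
                     (toℚᵘ-/ (+ 1) c) ⟩
    (+ 1 ℚᵘ./ a ℚᵘ.+ + 1 ℚᵘ./ b) ℚᵘ.+ + 1 ℚᵘ./ c
      ≡⟨ cong (ℚᵘ._+ + 1 ℚᵘ./ c) (/ᵘ-+-/ᵘ 1 1 a-1 b-1) ⟩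
    + (1 * b + 1 * a) ℚᵘ./ (a * b) ℚᵘ.+ + 1 ℚᵘ./ c
      ≡⟨ /ᵘ-+-/ᵘ (1 * b + 1 * a) 1 _ c-1 ⟩
    + ((1 * b + 1 * a) * c + 1 * (a * b)) ℚᵘ./ (a * b * c)
      ≡⟨ cong (λ m → + m ℚᵘ./ (a * b * c)) (numerator a b c) ⟩
    + (b * c + a * c + a * b) ℚᵘ./ (a * b * c) ∎
    where open ℚᵘP.≃-Reasoning

pos-*-≡ : ∀ m n {i j} → + m ≡ i → + n ≡ j → + (m * n) ≡ i ℤ.* j
pos-*-≡ m n p q = trans (ℤP.pos-* m n) (cong₂ ℤ._*_ p q)

R-equation⇔ : ∀ n x z t → (+ n ≡ R (+ x) (+ 1) (+ t) (+ z))
                        ⇔ n + 4 * x * x + (3 + 4 * t) ≡ 4 * x * z * (3 + 4 * t)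
R-equation⇔ n x z t = mk⇔
  (λ eq → ℤP.+-injective (trans lhs-cast (trans (cong (λ r → r ℤ.+ 4X² ℤ.+ S) eq)
                                                (trans (R-identity (+ x) (+ z) (+ t)) (sym rhs-cast)))))
  (λ eq → ∙-cancelʳ 4X² _ _ (∙-cancelʳ S _ _
             (trans (sym lhs-cast) (trans (cong +_ eq) (trans rhs-cast (sym (R-identity (+ x) (+ z) (+ t))))))))
  where
  S 4X² : ℤ
  S = + 3 ℤ.+ + 4 ℤ.* + t
  4X² = + 4 ℤ.* + x ℤ.* + x
  4x²-cast : + (4 * x * x) ≡ 4X²
  4x²-cast = pos-*-≡ (4 * x) x (ℤP.pos-* 4 x) refl
  S-cast : + (3 + 4 * t) ≡ S
  S-cast = cong (λ i → + 3 ℤ.+ i) (ℤP.pos-* 4 t)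
  lhs-cast : + (n + 4 * x * x + (3 + 4 * t)) ≡ + n ℤ.+ 4X² ℤ.+ S
  lhs-cast = cong₂ (λ i j → + n ℤ.+ i ℤ.+ j) 4x²-cast S-cast
  rhs-cast : + (4 * x * z * (3 + 4 * t)) ≡ + 4 ℤ.* + x ℤ.* + z ℤ.* S
  rhs-cast = pos-*-≡ (4 * x * z) (3 + 4 * t) (pos-*-≡ (4 * x) z (ℤP.pos-* 4 x) refl) S-cast
  -- R is unfolded here because the ring solver cannot see through it.
  R-identity : ∀ X Z T → ((+ 4 ℤ.* X ℤ.* + 1 ℤ.* Z ℤ.- + 1) ℤ.* (+ 3 ℤ.+ + 4 ℤ.* T) ℤ.- + 4 ℤ.* X ℤ.* X ℤ.* + 1)
                         ℤ.+ + 4 ℤ.* X ℤ.* X ℤ.+ (+ 3 ℤ.+ + 4 ℤ.* T)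
                         ≡ + 4 ℤ.* X ℤ.* Z ℤ.* (+ 3 ℤ.+ + 4 ℤ.* T)
  R-identity = ℤSolver.solve-∀

R-equation⇔factorization : ∀ k x z t .{{_ : NonZero x}} →
  (suc (4 * k) + 4 * x * x + (3 + 4 * t) ≡ 4 * x * z * (3 + 4 * t))
  ⇔ (∃[ b ] (x * b ≡ k + 1 + t × x + b ≡ z * (3 + 4 * t)))
R-equation⇔factorization k x z t = ⇔.trans
  (mk⇔ (λ eq → ℕP.*-cancelˡ-≡ _ _ 4 (trans (lhs k x t) (trans eq (rhs x z t))))
       (λ eq → trans (sym (lhs k x t)) (trans (cong (4 *_) eq) (sym (rhs x z t)))))
  (x*x+c≡x*y⇔ x (k + 1 + t) (z * (3 + 4 * t)))
  where
  lhs : ∀ k x t → 4 * (x * x + (k + 1 + t)) ≡ suc (4 * k) + 4 * x * x + (3 + 4 * t)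
  lhs = ℕSolver.solve-∀
  rhs : ∀ x z t → 4 * x * z * (3 + 4 * t) ≡ 4 * (x * (z * (3 + 4 * t)))
  rhs = ℕSolver.solve-∀

congruence⇔divisibility : ∀ n d m → let d⁺ = suc d; m⁺ = suc m in
  (ℤD._∣_ (+ 4 ℤ.* + d⁺ ℤ.* + m⁺ ℤ.- + 1) (ℤ.- + suc n ℤ.- + 4 ℤ.* + d⁺ ℤ.* + d⁺))
  ⇔ (4 * d⁺ * m⁺ ∸ 1) ∣ (suc n + 4 * d⁺ * d⁺)
congruence⇔divisibility n d m = mk⇔ (subst (divisor ∣_) absolute-value) (subst (divisor ∣_) (sym absolute-value))
  where
  divisor : ℕ
  divisor = 4 * suc d * suc m ∸ 1
  absolute-value : ℤ.∣ ℤ.- + suc n ℤ.- + 4 ℤ.* + suc d ℤ.* + suc d ∣ ≡ suc n + 4 * suc d * suc d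
  absolute-value = cong suc (sym (ℕP.+-suc n _))

[4dm∸1]%4≡3 : ∀ d m .{{_ : NonZero d}} .{{_ : NonZero m}} → (4 * d * m ∸ 1) % 4 ≡ 3
[4dm∸1]%4≡3 (suc d) (suc m) =
  trans (cong (λ x → (x ∸ 1) % 4) (identity d m)) ([m+kn]%n≡m%n 3 (m + d * suc m) 4)
  where
  identity : ∀ d m → 4 * suc d * suc m ≡ 4 + (m + d * suc m) * 4
  identity = ℕSolver.solve-∀

[1+4k+4dd]%4≡1 : ∀ k d → (suc (4 * k) + 4 * d * d) % 4 ≡ 1
[1+4k+4dd]%4≡1 k d = trans (cong (_% 4) (identity k d)) ([m+kn]%n≡m%n 1 (k + d * d) 4)
  where
  identity : ∀ k d → suc (4 * k) + 4 * d * d ≡ 1 + (k + d * d) * 4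
  identity = ℕSolver.solve-∀

egyptian⇔ : ∀ n u v w → let n⁺ = suc n; u⁺ = suc u; v⁺ = suc v; w⁺ = suc w in
  (+ 4 ℚ./ n⁺ ≡ inv (u⁺ * v⁺) ℚ.+ inv (u⁺ * w⁺ * n⁺) ℚ.+ inv (v⁺ * w⁺ * n⁺))
  ⇔ 4 * u⁺ * v⁺ * w⁺ ≡ w⁺ * n⁺ + v⁺ + u⁺
egyptian⇔ n u v w = ⇔.trans (/≡inv+inv+inv⇔ 4 n⁺ (u⁺ * v⁺) (u⁺ * w⁺ * n⁺) (v⁺ * w⁺ * n⁺)) (mk⇔
  (λ eq → ℕP.*-cancelˡ-≡ _ _ (u⁺ * v⁺ * w⁺ * n⁺ * n⁺) (trans (sym (lhs u⁺ v⁺ w⁺ n⁺)) (trans eq (rhs u⁺ v⁺ w⁺ n⁺))))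
  (λ eq → trans (lhs u⁺ v⁺ w⁺ n⁺) (trans (cong (u⁺ * v⁺ * w⁺ * n⁺ * n⁺ *_) eq) (sym (rhs u⁺ v⁺ w⁺ n⁺)))))
  where
  n⁺ u⁺ v⁺ w⁺ : ℕ
  n⁺ = suc n
  u⁺ = suc u
  v⁺ = suc v
  w⁺ = suc w
  lhs : ∀ u v w n → 4 * (u * v * (u * w * n) * (v * w * n)) ≡ u * v * w * n * n * (4 * u * v * w)
  lhs = ℕSolver.solve-∀
  rhs : ∀ u v w n → (u * w * n * (v * w * n) + u * v * (v * w * n) + u * v * (u * w * n)) * n
                    ≡ u * v * w * n * n * (w * n + v + u)
  rhs = ℕSolver.solve-∀

egyptian-equation⇔factorization : ∀ k u v w .{{_ : NonZero w}} →
  (4 * u * v * w ≡ w * suc (4 * k) + v + u)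
  ⇔ (∃[ t ] (u * v ≡ k + 1 + t × u + v ≡ w * (3 + 4 * t)))
egyptian-equation⇔factorization k u v w = mk⇔
  (λ eq → let t = u * v ∸ suc k
              uv≡k+1+t = trans (sym (ℕP.m+[n∸m]≡n (k<uv eq))) (cong (_+ t) (ℕP.+-comm 1 k)) in
    t , uv≡k+1+t , ℕP.+-cancelˡ-≡ (w * n) _ _ (trans (trans (regroup w n u v) (sym eq)) (expand t uv≡k+1+t)))
  (λ { (t , uv≡k+1+t , u+v≡wS) →
    trans (expand t uv≡k+1+t) (trans (cong (λ m → w * n + m) (sym u+v≡wS)) (regroup w n u v)) })
  where
  open ℕP.≤-Reasoning
  n : ℕ
  n = suc (4 * k)
  regroup : ∀ w n u v → w * n + (u + v) ≡ w * n + v + u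
  regroup = ℕSolver.solve-∀
  4[k+1+t]w≡w[n+S] : ∀ k t w → 4 * (k + 1 + t) * w ≡ w * suc (4 * k) + w * (3 + 4 * t)
  4[k+1+t]w≡w[n+S] = ℕSolver.solve-∀
  4uvw≡4[uv]w : ∀ u v w → 4 * u * v * w ≡ 4 * (u * v) * w
  4uvw≡4[uv]w = ℕSolver.solve-∀
  expand : ∀ t → u * v ≡ k + 1 + t → 4 * u * v * w ≡ w * n + w * (3 + 4 * t)
  expand t uv≡k+1+t =
    trans (4uvw≡4[uv]w u v w) (trans (cong (λ c → 4 * c * w) uv≡k+1+t) (4[k+1+t]w≡w[n+S] k t w))
  k<uv : 4 * u * v * w ≡ w * n + v + u → k < u * v
  k<uv eq = ℕP.*-cancelʳ-< (4 * w) k (u * v) (begin-strict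
    k * (4 * w)                   <⟨ ℕP.m<m+n (k * (4 * w)) (>-nonZero⁻¹ w) ⟩
    k * (4 * w) + w               ≤⟨ ℕP.m≤m+n (k * (4 * w) + w) (v + u) ⟩
    k * (4 * w) + w + (v + u)     ≡⟨ bound k w u v ⟩
    w * n + v + u                 ≡⟨ eq ⟨
    4 * u * v * w                 ≡⟨ 4uvw≡[uv][4w] u v w ⟩
    u * v * (4 * w)               ∎)
    where
    bound : ∀ k w u v → k * (4 * w) + w + (v + u) ≡ w * suc (4 * k) + v + u
    bound = ℕSolver.solve-∀
    4uvw≡[uv][4w] : ∀ u v w → 4 * u * v * w ≡ u * v * (4 * w)
    4uvw≡[uv][4w] = ℕSolver.solve-∀

RSolvable CongruenceSolvable EgyptianSolvable FactorizationSolvable : ℕ → Set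
RSolvable k =
  ∃[ x₀ ] ∃[ z₀ ] ∃[ t₀ ] (0 < x₀ × 0 < z₀ × + suc (4 * k) ≡ R (+ x₀) (+ 1) (+ t₀) (+ z₀))
CongruenceSolvable k =
  ∃[ d ] ∃[ m ] (0 < d × 0 < m ×
    ℤD._∣_ (+ 4 ℤ.* + d ℤ.* + m ℤ.- + 1) (ℤ.- + suc (4 * k) ℤ.- + 4 ℤ.* + d ℤ.* + d))
EgyptianSolvable k = let n = suc (4 * k) in
  ∃[ u ] ∃[ v ] ∃[ w ]
    (+ 4 ℚ./ n ≡ inv (suc u * suc v) ℚ.+ inv (suc u * suc w * n) ℚ.+ inv (suc v * suc w * n))
FactorizationSolvable k =
  ∃[ t ] ∃[ a ] ∃[ b ] (0 < a × 0 < b × a * b ≡ k + 1 + t × (3 + 4 * t) ∣ (a + b))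

R⇔congruence : ∀ k → RSolvable k ⇔ CongruenceSolvable k
R⇔congruence k = mk⇔ R⇒congruence congruence⇒R
  where
  R⇒congruence : RSolvable k → CongruenceSolvable k
  R⇒congruence (x@(suc x-1) , z@(suc z-1) , t , 0<x , 0<z , eq) =
    x , z , 0<x , 0<z , from (congruence⇔divisibility (4 * k) x-1 z-1)
      (divides (3 + 4 * t) (to (+≡suc*⇔ _ _ (4 * x * z ∸ 1)) (to (R-equation⇔ _ x z t) eq)))
  congruence⇒R : CongruenceSolvable k → RSolvable k
  congruence⇒R (d@(suc d-1) , m@(suc m-1) , 0<d , 0<m , dvd)
    with divides q eq ← to (congruence⇔divisibility (4 * k) d-1 m-1) dvd
    with t , refl ← cofactor≡3-mod-4 q (4 * d * m ∸ 1) ([4dm∸1]%4≡3 d m)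
                          (trans (cong (_% 4) (sym eq)) ([1+4k+4dd]%4≡1 k d)) =
    d , m , t , 0<d , 0<m , from (R-equation⇔ _ d m t) (from (+≡suc*⇔ _ _ (4 * d * m ∸ 1)) eq)

R⇔factorization : ∀ k → RSolvable k ⇔ FactorizationSolvable k
R⇔factorization k = mk⇔ R⇒factorization factorization⇒R
  where
  R⇒factorization : RSolvable k → FactorizationSolvable k
  R⇒factorization (x@(suc _) , z , t , 0<x , _ , eq) =
    let b , xb≡k+1+t , x+b≡zS = to (R-equation⇔factorization k x z t)
                                  (to (R-equation⇔ _ x z t) eq)
    in t , x , b , 0<x , m*n≡1+o⇒n>0 x b (trans xb≡k+1+t (cong (_+ t) (ℕP.+-comm k 1))) ,
       xb≡k+1+t , divides z x+b≡zS
  factorization⇒R : FactorizationSolvable k → RSolvable k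
  factorization⇒R (t , suc _ , _ , _ , _ , _ , divides zero ())
  factorization⇒R (t , a@(suc _) , b , 0<a , _ , ab≡k+1+t , divides z@(suc _) a+b≡zS) =
    a , z , t , 0<a , z<s , from (R-equation⇔ _ a z t)
      (from (R-equation⇔factorization k a z t) (b , ab≡k+1+t , a+b≡zS))

egyptian⇔factorization : ∀ k → EgyptianSolvable k ⇔ FactorizationSolvable k
egyptian⇔factorization k = mk⇔ egyptian⇒factorization factorization⇒egyptian
  where
  egyptian⇒factorization : EgyptianSolvable k → FactorizationSolvable k
  egyptian⇒factorization (u , v , w , eq) =
    let t , uv≡k+1+t , u+v≡wS = to (egyptian-equation⇔factorization k (suc u) (suc v) (suc w))
                                  (to (egyptian⇔ (4 * k) u v w) eq)
    in t , suc u , suc v , z<s , z<s , uv≡k+1+t , divides (suc w) u+v≡wS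
  factorization⇒egyptian : FactorizationSolvable k → EgyptianSolvable k
  factorization⇒egyptian (t , suc _ , _ , _ , _ , _ , divides zero ())
  factorization⇒egyptian (t , suc a , suc b , _ , _ , ab≡k+1+t , divides (suc w) a+b≡wS) =
    a , b , w , from (egyptian⇔ (4 * k) a b w)
      (from (egyptian-equation⇔factorization k (suc a) (suc b) (suc w)) (t , ab≡k+1+t , a+b≡wS))

theorem9 : (k : ℕ) →
    let n = suc (4 * k) in
    let i = ∃[ x₀ ] ∃[ z₀ ] ∃[ t₀ ] (0 < x₀ × 0 < z₀ × + n ≡ R (+ x₀) (+ 1) (+ t₀) (+ z₀)) in
    let ii = ∃[ d ] ∃[ m ] (0 < d × 0 < m × (ℤD._∣_ ((+ 4) ℤ.* (+ d) ℤ.* (+ m) ℤ.- + 1) (ℤ.- (+ n) ℤ.- (+ 4) ℤ.* (+ d) ℤ.* (+ d)))) in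
    let iii = ∃[ u ] ∃[ v ] ∃[ w ] (((+ 4) ℚ./ n) ≡ inv (suc u * suc v) ℚ.+ inv (suc u * suc w * n) ℚ.+ inv (suc v * suc w * n)) in
    let iv = ∃[ t ] ∃[ a ] ∃[ b ] (0 < a × 0 < b × a * b ≡ k + 1 + t × (3 + 4 * t) ∣ (a + b)) in
    (i ⇔ ii) × (ii ⇔ iii) × (iii ⇔ iv)
theorem9 k =
  R⇔congruence k ,
  ⇔.trans (⇔.sym (R⇔congruence k)) (⇔.trans (R⇔factorization k) (⇔.sym (egyptian⇔factorization k))) ,
  egyptian⇔factorization k
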